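{- Let $\theta$ be a pfo-formula. The following are equivalent: (i) the rule $\to_M$ can be applied to $\theta$; (ii) $\to_M$ can be applied to $[\theta]_{ACO}$; (iii) $\to_M$ can be applied to $[\theta]_{\mathcal{T}}$.
   Context: A pfo-formula is a relational first-order formula with no negation ($\wedge,\vee$ binary); $\mathrm{free}(\psi)$ is its set of free variables. Rewriting rules (applicable to any subformula occurrence; $\oplus\in\{\wedge,\vee\}$, $Q\in\{\exists,\forall\}$): $A$: $F_1\oplus(F_2\oplus F_3)\to(F_1\oplus F_2)\oplus F_3$ and its converse; $C$: $F_1\oplus F_2\to F_2\oplus F_1$; $O$: $QxQyF\to QyQxF$; $P\!\downarrow$: $\exists x(F_1\wedge F_2)\to(\exists xF_1)\wedge F_2$ and $\forall x(F_1\vee F_2)\to(\forall xF_1)\vee F_2$ whenever $x\notin\mathrm{free}(F_2)$; $P\!\uparrow$: inverse of $P\!\downarrow$; $N$: $QxF\to QyF'$ when $y\notin\mathrm{free}(F)$ and $F'$ arises from $F$ by replacing each free occurrence of $x$ by $y$; $M$: $QxF\to F$ when $x\notin\mathrm{free}(F)$. $\mathcal{T}=\{A,C,O,P\!\downarrow,P\!\uparrow,N\}$. For a set $\mathcal{R}$ of rules, $[\theta]_{\mathcal{R}}$ is the equivalence class of $\theta$ under the reflexive-transitive closure of the union of the rules in $\mathcal{R}$ and their inverses. A rule $\to$ can be applied to a formula $\theta$ if $\theta\to\theta'$ for some $\theta'$, and to a set $S$ of formulas if it can be applied to some element of $S$. -}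

module Defs where

open import Data.Nat using (ℕ)
open import Data.List using (List; map)
open import Data.List.Membership.Propositional using (_∈_)
open import Data.Product using (Σ; ∃; _×_; _,_)
open import Data.Bool using (if_then_else_)
open import Relation.Nullary using (¬_)
open import Relation.Nullary.Decidable using (⌊_⌋)
open import Relation.Binary.PropositionalEquality using (_≡_; _≢_)
open import Relation.Binary.Construct.Union using (_∪_)
open import Relation.Binary.Construct.Closure.Equivalence using (EqClosure)
import Data.Nat as ℕ

Var : Set
Var = ℕ

data BinOp : Set where
  and or : BinOp

data Quant : Set where
  ex all : Quant

-- pfo-formulas: relational, negation-free first-order formulas.
-- atom R xs  is the atom R(x₁,…,xₖ)
data Formula : Set where
  atom : ℕ → List Var → Formula
  bin  : BinOp → Formula → Formula → Formula
  qu   : Quant → Var → Formula → Formula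

data FreeIn (x : Var) : Formula → Set where
  atomF : ∀ {R xs} → x ∈ xs → FreeIn x (atom R xs)
  binL  : ∀ {o F G} → FreeIn x F → FreeIn x (bin o F G)
  binR  : ∀ {o F G} → FreeIn x G → FreeIn x (bin o F G)
  quF   : ∀ {q y F} → y ≢ x → FreeIn x F → FreeIn x (qu q y F)

renameVar : Var → Var → Var → Var
renameVar x y z = if ⌊ z ℕ.≟ x ⌋ then y else z

rename : Var → Var → Formula → Formula
rename x y (atom R xs) = atom R (map (renameVar x y) xs)
rename x y (bin o F G) = bin o (rename x y F) (rename x y G)
rename x y (qu q z F)  = if ⌊ z ℕ.≟ x ⌋ then qu q z F else qu q z (rename x y F)

-- y is free for x in F: no free occurrence of x in F lies in the
-- scope of a quantifier binding y (so the replaced occurrences stay free)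
data FreeFor (y x : Var) : Formula → Set where
  atomFF : ∀ {R xs} → FreeFor y x (atom R xs)
  binFF  : ∀ {o F G} → FreeFor y x F → FreeFor y x G → FreeFor y x (bin o F G)
  quNF   : ∀ {q z F} → ¬ FreeIn x (qu q z F) → FreeFor y x (qu q z F)
  quFF   : ∀ {q z F} → z ≢ y → FreeFor y x F → FreeFor y x (qu q z F)

Rel : Set₁
Rel = Formula → Formula → Set

data RuleA : Rel where
  assoc   : ∀ o F₁ F₂ F₃ → RuleA (bin o F₁ (bin o F₂ F₃)) (bin o (bin o F₁ F₂) F₃)
  unassoc : ∀ o F₁ F₂ F₃ → RuleA (bin o (bin o F₁ F₂) F₃) (bin o F₁ (bin o F₂ F₃))

data RuleC : Rel where
  comm : ∀ o F₁ F₂ → RuleC (bin o F₁ F₂) (bin o F₂ F₁)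

data RuleO : Rel where
  swap : ∀ q x y F → RuleO (qu q x (qu q y F)) (qu q y (qu q x F))

data RulePdown : Rel where
  pushEx  : ∀ x F₁ F₂ → ¬ FreeIn x F₂ →
            RulePdown (qu ex x (bin and F₁ F₂)) (bin and (qu ex x F₁) F₂)
  pushAll : ∀ x F₁ F₂ → ¬ FreeIn x F₂ →
            RulePdown (qu all x (bin or F₁ F₂)) (bin or (qu all x F₁) F₂)

RulePup : Rel
RulePup F G = RulePdown G F

data RuleN : Rel where
  ren : ∀ q x y F → ¬ FreeIn y F → FreeFor y x F →
        RuleN (qu q x F) (qu q y (rename x y F))

data RuleM : Rel where
  drop : ∀ q x F → ¬ FreeIn x F → RuleM (qu q x F) F

data Ctx (R : Rel) : Rel where
  here : ∀ {F G} → R F G → Ctx R F G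
  inL  : ∀ {o F F' G} → Ctx R F F' → Ctx R (bin o F G) (bin o F' G)
  inR  : ∀ {o F G G'} → Ctx R G G' → Ctx R (bin o F G) (bin o F G')
  inQ  : ∀ {q x F F'} → Ctx R F F' → Ctx R (qu q x F) (qu q x F')

-- θ ≈ θ' in [θ]_R (reflexive-symmetric-transitive closure)
_≈[_]_ : Formula → Rel → Formula → Set
θ ≈[ R ] θ' = EqClosure (Ctx R) θ θ'

ACO : Rel
ACO = RuleA ∪ RuleC ∪ RuleO

𝒯 : Rel
𝒯 = RuleA ∪ RuleC ∪ RuleO ∪ RulePdown ∪ RulePup ∪ RuleN

ApplicableTo : Rel → Formula → Set
ApplicableTo R θ = ∃ λ θ' → Ctx R θ θ'

ApplicableToClass : Rel → Rel → Formula → Set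
ApplicableToClass R S θ = ∃ λ θ' → (θ ≈[ S ] θ') × ApplicableTo R θ'

{-# OPTIONS --safe #-}
module Submission where

-- Rule M applies to θ exactly when θ has a vacuous quantifier, i.e. a subformula Q x F
-- with x ∉ free(F). Every rule of 𝒯, read in either direction and applied anywhere
-- inside a formula, preserves both the set of free variables and the existence of a
-- vacuous quantifier; hence so does 𝒯-equivalence, and a fortiori ACO-equivalence.
-- The only delicate rule is N, where "y is free for x" prevents a capture that would
-- make a vacuous quantifier binding y non-vacuous.

open import Defs
open import Data.Nat using (_≟_)
open import Data.List using (map)
open import Data.List.Membership.Propositional using (_∈_)
open import Data.List.Membership.Propositional.Properties using (∈-map⁺; ∈-map⁻)
open import Data.List.Properties using (map-id-local)
import Data.List.Relation.Unary.All as All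
open import Data.List.Relation.Unary.All.Properties using (¬Any⇒All¬)
open import Data.Product using (_×_; _,_; proj₁; map₁)
import Data.Sum as Sum
open import Data.Sum using (_⊎_; inj₁; inj₂; [_,_]′)
open import Data.Empty using (⊥-elim)
open import Function.Base using (id; _∘_)
open import Function.Bundles using (_⇔_; mk⇔)
open import Relation.Nullary using (¬_; yes; no)
open import Relation.Binary.Core using (_⇒_)
open import Relation.Binary.Structures using (IsEquivalence)
open import Relation.Binary.PropositionalEquality
  using (_≡_; _≢_; refl; sym; cong; cong₂; subst)
open import Relation.Binary.Construct.Closure.ReflexiveTransitive using (ε)
import Relation.Binary.Construct.Closure.Equivalence as EqClosure

data HasVacuousQuantifier : Formula → Set where
  here : ∀ {q x F} → ¬ FreeIn x F → HasVacuousQuantifier (qu q x F)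
  inL  : ∀ {o F G} → HasVacuousQuantifier F → HasVacuousQuantifier (bin o F G)
  inR  : ∀ {o F G} → HasVacuousQuantifier G → HasVacuousQuantifier (bin o F G)
  inQ  : ∀ {q x F} → HasVacuousQuantifier F → HasVacuousQuantifier (qu q x F)

M-applicable⇒vacuous : ∀ {θ} → ApplicableTo RuleM θ → HasVacuousQuantifier θ
M-applicable⇒vacuous (_ , step) = vacuous step
  where
  vacuous : ∀ {θ θ'} → Ctx RuleM θ θ' → HasVacuousQuantifier θ
  vacuous (here (drop q x F x∉F)) = here x∉F
  vacuous (inL step)              = inL (vacuous step)
  vacuous (inR step)              = inR (vacuous step)
  vacuous (inQ step)              = inQ (vacuous step)

vacuous⇒M-applicable : ∀ {θ} → HasVacuousQuantifier θ → ApplicableTo RuleM θ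
vacuous⇒M-applicable (here {q} {x} {F} x∉F) = F , here (drop q x F x∉F)
vacuous⇒M-applicable (inL v) with _ , step ← vacuous⇒M-applicable v = _ , inL step
vacuous⇒M-applicable (inR v) with _ , step ← vacuous⇒M-applicable v = _ , inR step
vacuous⇒M-applicable (inQ v) with _ , step ← vacuous⇒M-applicable v = _ , inQ step

-- Vacuity of Q x F depends on free(F), so the free variables have to be part of the
-- invariant for it to be a congruence.
record _∼_ (F G : Formula) : Set where
  constructor mk∼
  field
    free⇒    : ∀ {z} → FreeIn z F → FreeIn z G
    free⇐    : ∀ {z} → FreeIn z G → FreeIn z F
    vacuous⇒ : HasVacuousQuantifier F → HasVacuousQuantifier G
    vacuous⇐ : HasVacuousQuantifier G → HasVacuousQuantifier F
open _∼_

∼-sym : ∀ {F G} → F ∼ G → G ∼ F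
∼-sym (mk∼ f⇒ f⇐ v⇒ v⇐) = mk∼ f⇐ f⇒ v⇐ v⇒

∼-trans : ∀ {F G H} → F ∼ G → G ∼ H → F ∼ H
∼-trans F∼G G∼H = mk∼ (free⇒ G∼H ∘ free⇒ F∼G) (free⇐ F∼G ∘ free⇐ G∼H)
                      (vacuous⇒ G∼H ∘ vacuous⇒ F∼G) (vacuous⇐ F∼G ∘ vacuous⇐ G∼H)

∼-isEquivalence : IsEquivalence _∼_
∼-isEquivalence = record { refl = mk∼ id id id id ; sym = ∼-sym ; trans = ∼-trans }

assoc-∼ : ∀ {o F₁ F₂ F₃} → bin o F₁ (bin o F₂ F₃) ∼ bin o (bin o F₁ F₂) F₃
assoc-∼ = mk∼ free⇒′ free⇐′ vacuous⇒′ vacuous⇐′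
  where
  free⇒′ : ∀ {o F₁ F₂ F₃ z} → FreeIn z (bin o F₁ (bin o F₂ F₃))
         → FreeIn z (bin o (bin o F₁ F₂) F₃)
  free⇒′ (binL f)        = binL (binL f)
  free⇒′ (binR (binL f)) = binL (binR f)
  free⇒′ (binR (binR f)) = binR f
  free⇐′ : ∀ {o F₁ F₂ F₃ z} → FreeIn z (bin o (bin o F₁ F₂) F₃)
         → FreeIn z (bin o F₁ (bin o F₂ F₃))
  free⇐′ (binL (binL f)) = binL f
  free⇐′ (binL (binR f)) = binR (binL f)
  free⇐′ (binR f)        = binR (binR f)
  vacuous⇒′ : ∀ {o F₁ F₂ F₃} → HasVacuousQuantifier (bin o F₁ (bin o F₂ F₃))
            → HasVacuousQuantifier (bin o (bin o F₁ F₂) F₃)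
  vacuous⇒′ (inL v)       = inL (inL v)
  vacuous⇒′ (inR (inL v)) = inL (inR v)
  vacuous⇒′ (inR (inR v)) = inR v
  vacuous⇐′ : ∀ {o F₁ F₂ F₃} → HasVacuousQuantifier (bin o (bin o F₁ F₂) F₃)
            → HasVacuousQuantifier (bin o F₁ (bin o F₂ F₃))
  vacuous⇐′ (inL (inL v)) = inL v
  vacuous⇐′ (inL (inR v)) = inR (inL v)
  vacuous⇐′ (inR v)       = inR (inR v)

comm-∼ : ∀ {o F G} → bin o F G ∼ bin o G F
comm-∼ = mk∼ free free vacuous vacuous
  where
  free : ∀ {o F G z} → FreeIn z (bin o F G) → FreeIn z (bin o G F)
  free (binL f) = binR f
  free (binR f) = binL f
  vacuous : ∀ {o F G} → HasVacuousQuantifier (bin o F G) → HasVacuousQuantifier (bin o G F)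
  vacuous (inL v) = inR v
  vacuous (inR v) = inL v

swap-∼ : ∀ {q x y F} → qu q x (qu q y F) ∼ qu q y (qu q x F)
swap-∼ = mk∼ free free vacuous vacuous
  where
  free : ∀ {q x y F z} → FreeIn z (qu q x (qu q y F)) → FreeIn z (qu q y (qu q x F))
  free (quF x≢z (quF y≢z f)) = quF y≢z (quF x≢z f)
  vacuous : ∀ {q x y F} → HasVacuousQuantifier (qu q x (qu q y F))
          → HasVacuousQuantifier (qu q y (qu q x F))
  vacuous {x = x} {y} (here x∉QyF) with x ≟ y
  ... | yes refl = here x∉QyF
  ... | no x≢y   = inQ (here (x∉QyF ∘ quF (x≢y ∘ sym)))
  vacuous (inQ (here y∉F)) = here λ { (quF _ y∈F) → y∉F y∈F }
  vacuous (inQ (inQ v))    = inQ (inQ v)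

push-∼ : ∀ {o q x F₁ F₂} → ¬ FreeIn x F₂ → qu q x (bin o F₁ F₂) ∼ bin o (qu q x F₁) F₂
push-∼ {o} {q} {x} {F₁} {F₂} x∉F₂ = mk∼ free⇒′ free⇐′ vacuous⇒′ vacuous⇐′
  where
  free⇒′ : ∀ {z} → FreeIn z (qu q x (bin o F₁ F₂)) → FreeIn z (bin o (qu q x F₁) F₂)
  free⇒′ (quF x≢z (binL f)) = binL (quF x≢z f)
  free⇒′ (quF x≢z (binR f)) = binR f
  free⇐′ : ∀ {z} → FreeIn z (bin o (qu q x F₁) F₂) → FreeIn z (qu q x (bin o F₁ F₂))
  free⇐′ (binL (quF x≢z f)) = quF x≢z (binL f)
  free⇐′ (binR f)           = quF (λ { refl → x∉F₂ f }) (binR f)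
  vacuous⇒′ : HasVacuousQuantifier (qu q x (bin o F₁ F₂))
            → HasVacuousQuantifier (bin o (qu q x F₁) F₂)
  vacuous⇒′ (here x∉F₁F₂)  = inL (here (x∉F₁F₂ ∘ binL))
  vacuous⇒′ (inQ (inL v)) = inL (inQ v)
  vacuous⇒′ (inQ (inR v)) = inR v
  vacuous⇐′ : HasVacuousQuantifier (bin o (qu q x F₁) F₂)
            → HasVacuousQuantifier (qu q x (bin o F₁ F₂))
  vacuous⇐′ (inL (here x∉F₁)) = here λ { (binL f) → x∉F₁ f ; (binR f) → x∉F₂ f }
  vacuous⇐′ (inL (inQ v))     = inQ (inL v)
  vacuous⇐′ (inR v)           = inQ (inR v)

renameVar-self : ∀ x y → renameVar x y x ≡ y
renameVar-self x y with x ≟ x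
... | yes _   = refl
... | no x≢x = ⊥-elim (x≢x refl)

renameVar-other : ∀ {x y w} → w ≢ x → renameVar x y w ≡ w
renameVar-other {x} {w = w} w≢x with w ≟ x
... | yes w≡x = ⊥-elim (w≢x w≡x)
... | no _    = refl

rename-notFree : ∀ {x y} F → ¬ FreeIn x F → rename x y F ≡ F
rename-notFree (atom R xs) x∉F =
  cong (atom R) (map-id-local (All.map (λ x≢w → renameVar-other (x≢w ∘ sym))
                                       (¬Any⇒All¬ xs (x∉F ∘ atomF))))
rename-notFree (bin o F G) x∉FG =
  cong₂ (bin o) (rename-notFree F (x∉FG ∘ binL)) (rename-notFree G (x∉FG ∘ binR))
rename-notFree {x} (qu q w F) x∉QwF with w ≟ x
... | yes _   = refl
... | no w≢x = cong (qu q w) (rename-notFree F (x∉QwF ∘ quF w≢x))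

FreeIn-rename⁻ : ∀ {x y z} F → FreeIn z (rename x y F) → z ≡ y ⊎ (FreeIn z F × z ≢ x)
FreeIn-rename⁻ {x} (atom R xs) (atomF z∈) with ∈-map⁻ (renameVar x _) z∈
... | w , w∈xs , refl with w ≟ x
...   | yes _   = inj₁ refl
...   | no w≢x = inj₂ (atomF w∈xs , w≢x)
FreeIn-rename⁻ (bin o F G) (binL f) = Sum.map₂ (map₁ binL) (FreeIn-rename⁻ F f)
FreeIn-rename⁻ (bin o F G) (binR f) = Sum.map₂ (map₁ binR) (FreeIn-rename⁻ G f)
FreeIn-rename⁻ {x} (qu q w F) f with w ≟ x
FreeIn-rename⁻ (qu q w F) (quF w≢z f) | yes refl = inj₂ (quF w≢z f , w≢z ∘ sym)
FreeIn-rename⁻ (qu q w F) (quF w≢z f) | no _     =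
  Sum.map₂ (map₁ (quF w≢z)) (FreeIn-rename⁻ F f)

FreeIn-rename⁺ : ∀ {x y z} F → FreeIn z F → z ≢ x → FreeIn z (rename x y F)
FreeIn-rename⁺ {x} {y} (atom R xs) (atomF z∈xs) z≢x =
  atomF (subst (_∈ map (renameVar x y) xs) (renameVar-other z≢x) (∈-map⁺ (renameVar x y) z∈xs))
FreeIn-rename⁺ (bin o F G) (binL f) z≢x = binL (FreeIn-rename⁺ F f z≢x)
FreeIn-rename⁺ (bin o F G) (binR f) z≢x = binR (FreeIn-rename⁺ G f z≢x)
FreeIn-rename⁺ {x} (qu q w F) (quF w≢z f) z≢x with w ≟ x
... | yes _ = quF w≢z f
... | no _  = quF w≢z (FreeIn-rename⁺ F f z≢x)

FreeIn-rename-target : ∀ {x y} F → FreeFor y x F → FreeIn x F → FreeIn y (rename x y F)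
FreeIn-rename-target {x} {y} (atom R xs) _ (atomF x∈xs) =
  atomF (subst (_∈ map (renameVar x y) xs) (renameVar-self x y) (∈-map⁺ (renameVar x y) x∈xs))
FreeIn-rename-target (bin o F G) (binFF ffF _) (binL f) = binL (FreeIn-rename-target F ffF f)
FreeIn-rename-target (bin o F G) (binFF _ ffG) (binR f) = binR (FreeIn-rename-target G ffG f)
FreeIn-rename-target (qu q w F) (quNF x∉QwF) f = ⊥-elim (x∉QwF f)
FreeIn-rename-target {x} (qu q w F) (quFF w≢y ff) (quF w≢x f) with w ≟ x
... | yes w≡x = ⊥-elim (w≢x w≡x)
... | no _    = quF w≢y (FreeIn-rename-target F ff f)

vacuous-rename⁺ : ∀ {x y} F → FreeFor y x F → HasVacuousQuantifier F
                → HasVacuousQuantifier (rename x y F)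
vacuous-rename⁺ (bin o F G) (binFF ffF _) (inL v) = inL (vacuous-rename⁺ F ffF v)
vacuous-rename⁺ (bin o F G) (binFF _ ffG) (inR v) = inR (vacuous-rename⁺ G ffG v)
vacuous-rename⁺ (qu q w F) (quNF x∉QwF) v =
  subst HasVacuousQuantifier (sym (rename-notFree (qu q w F) x∉QwF)) v
vacuous-rename⁺ {x} (qu q w F) (quFF w≢y ff) v with w ≟ x
vacuous-rename⁺ (qu q w F) (quFF w≢y ff) v          | yes _ = v
vacuous-rename⁺ (qu q w F) (quFF w≢y ff) (here w∉F) | no _  =
  here λ w∈F′ → [ w≢y , w∉F ∘ proj₁ ]′ (FreeIn-rename⁻ F w∈F′)
vacuous-rename⁺ (qu q w F) (quFF w≢y ff) (inQ v)    | no _  = inQ (vacuous-rename⁺ F ff v)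

vacuous-rename⁻ : ∀ {x y} F → HasVacuousQuantifier (rename x y F) → HasVacuousQuantifier F
vacuous-rename⁻ (bin o F G) (inL v) = inL (vacuous-rename⁻ F v)
vacuous-rename⁻ (bin o F G) (inR v) = inR (vacuous-rename⁻ G v)
vacuous-rename⁻ {x} (qu q w F) v with w ≟ x
vacuous-rename⁻ (qu q w F) v           | yes _   = v
vacuous-rename⁻ (qu q w F) (here w∉F′) | no w≢x =
  here λ w∈F → w∉F′ (FreeIn-rename⁺ F w∈F w≢x)
vacuous-rename⁻ (qu q w F) (inQ v)     | no _    = inQ (vacuous-rename⁻ F v)

rename-∼ : ∀ {q x y F} → ¬ FreeIn y F → FreeFor y x F → qu q x F ∼ qu q y (rename x y F)
rename-∼ {q} {x} {y} {F} y∉F ff = mk∼ free⇒′ free⇐′ vacuous⇒′ vacuous⇐′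
  where
  free⇒′ : ∀ {z} → FreeIn z (qu q x F) → FreeIn z (qu q y (rename x y F))
  free⇒′ (quF x≢z f) = quF (λ { refl → y∉F f }) (FreeIn-rename⁺ F f (x≢z ∘ sym))
  free⇐′ : ∀ {z} → FreeIn z (qu q y (rename x y F)) → FreeIn z (qu q x F)
  free⇐′ (quF y≢z f) with FreeIn-rename⁻ F f
  ... | inj₁ z≡y         = ⊥-elim (y≢z (sym z≡y))
  ... | inj₂ (f′ , z≢x) = quF (z≢x ∘ sym) f′
  vacuous⇒′ : HasVacuousQuantifier (qu q x F)
            → HasVacuousQuantifier (qu q y (rename x y F))
  vacuous⇒′ (here x∉F) = here (subst (¬_ ∘ FreeIn y) (sym (rename-notFree F x∉F)) y∉F)
  vacuous⇒′ (inQ v)     = inQ (vacuous-rename⁺ F ff v)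
  vacuous⇐′ : HasVacuousQuantifier (qu q y (rename x y F))
            → HasVacuousQuantifier (qu q x F)
  vacuous⇐′ (here y∉F′) = here (y∉F′ ∘ FreeIn-rename-target F ff)
  vacuous⇐′ (inQ v)      = inQ (vacuous-rename⁻ F v)

bin-congˡ : ∀ {o F F′ G} → F ∼ F′ → bin o F G ∼ bin o F′ G
bin-congˡ F∼F′ = mk∼ (free F∼F′) (free (∼-sym F∼F′)) (vacuous F∼F′) (vacuous (∼-sym F∼F′))
  where
  free : ∀ {o F F′ G z} → F ∼ F′ → FreeIn z (bin o F G) → FreeIn z (bin o F′ G)
  free F∼F′ (binL f) = binL (free⇒ F∼F′ f)
  free _    (binR f) = binR f
  vacuous : ∀ {o F F′ G} → F ∼ F′
          → HasVacuousQuantifier (bin o F G) → HasVacuousQuantifier (bin o F′ G)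
  vacuous F∼F′ (inL v) = inL (vacuous⇒ F∼F′ v)
  vacuous _    (inR v) = inR v

bin-congʳ : ∀ {o F G G′} → G ∼ G′ → bin o F G ∼ bin o F G′
bin-congʳ G∼G′ = ∼-trans comm-∼ (∼-trans (bin-congˡ G∼G′) comm-∼)

qu-cong : ∀ {q x F F′} → F ∼ F′ → qu q x F ∼ qu q x F′
qu-cong F∼F′ = mk∼ (free F∼F′) (free (∼-sym F∼F′)) (vacuous F∼F′) (vacuous (∼-sym F∼F′))
  where
  free : ∀ {q x F F′ z} → F ∼ F′ → FreeIn z (qu q x F) → FreeIn z (qu q x F′)
  free F∼F′ (quF x≢z f) = quF x≢z (free⇒ F∼F′ f)
  vacuous : ∀ {q x F F′} → F ∼ F′
          → HasVacuousQuantifier (qu q x F) → HasVacuousQuantifier (qu q x F′)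
  vacuous F∼F′ (here x∉F) = here (x∉F ∘ free⇐ F∼F′)
  vacuous F∼F′ (inQ v)     = inQ (vacuous⇒ F∼F′ v)

Ctx-∼ : ∀ {R} → R ⇒ _∼_ → Ctx R ⇒ _∼_
Ctx-∼ R⇒∼ (here r)   = R⇒∼ r
Ctx-∼ R⇒∼ (inL step) = bin-congˡ (Ctx-∼ R⇒∼ step)
Ctx-∼ R⇒∼ (inR step) = bin-congʳ (Ctx-∼ R⇒∼ step)
Ctx-∼ R⇒∼ (inQ step) = qu-cong (Ctx-∼ R⇒∼ step)

Ctx-map : ∀ {R S} → R ⇒ S → Ctx R ⇒ Ctx S
Ctx-map R⇒S (here r)   = here (R⇒S r)
Ctx-map R⇒S (inL step) = inL (Ctx-map R⇒S step)
Ctx-map R⇒S (inR step) = inR (Ctx-map R⇒S step)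
Ctx-map R⇒S (inQ step) = inQ (Ctx-map R⇒S step)

RuleA⇒∼ : RuleA ⇒ _∼_
RuleA⇒∼ (assoc _ _ _ _)   = assoc-∼
RuleA⇒∼ (unassoc _ _ _ _) = ∼-sym assoc-∼

RuleC⇒∼ : RuleC ⇒ _∼_
RuleC⇒∼ (comm _ _ _) = comm-∼

RuleO⇒∼ : RuleO ⇒ _∼_
RuleO⇒∼ (swap _ _ _ _) = swap-∼

RulePdown⇒∼ : RulePdown ⇒ _∼_
RulePdown⇒∼ (pushEx _ _ _ x∉F₂)  = push-∼ x∉F₂
RulePdown⇒∼ (pushAll _ _ _ x∉F₂) = push-∼ x∉F₂

RuleN⇒∼ : RuleN ⇒ _∼_
RuleN⇒∼ (ren _ _ _ _ y∉F ff) = rename-∼ y∉F ff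

𝒯⇒∼ : 𝒯 ⇒ _∼_
𝒯⇒∼ = [ RuleA⇒∼ , [ RuleC⇒∼ , [ RuleO⇒∼ ,
        [ RulePdown⇒∼ , [ ∼-sym ∘ RulePdown⇒∼ , RuleN⇒∼ ]′ ]′ ]′ ]′ ]′

ACO⇒𝒯 : ACO ⇒ 𝒯
ACO⇒𝒯 = Sum.map₂ (Sum.map₂ inj₁)

applicableTo⇒applicableToClass : ∀ {R S θ} → ApplicableTo R θ → ApplicableToClass R S θ
applicableTo⇒applicableToClass ap = _ , ε , ap

applicableToClass-mono : ∀ {R S S′ θ} → S ⇒ S′
                       → ApplicableToClass R S θ → ApplicableToClass R S′ θ
applicableToClass-mono S⇒S′ (θ′ , θ≈θ′ , ap) = θ′ , EqClosure.map (Ctx-map S⇒S′) θ≈θ′ , ap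

M-applicableToClass⇒applicableTo : ∀ {S θ} → S ⇒ _∼_
                                 → ApplicableToClass RuleM S θ → ApplicableTo RuleM θ
M-applicableToClass⇒applicableTo S⇒∼ (_ , θ≈θ′ , ap) =
  vacuous⇒M-applicable (vacuous⇐ (EqClosure.fold ∼-isEquivalence (Ctx-∼ S⇒∼) θ≈θ′)
                                 (M-applicable⇒vacuous ap))

lemma6p1 : (θ : Formula) →
    (ApplicableTo RuleM θ ⇔ ApplicableToClass RuleM ACO θ)
    × (ApplicableToClass RuleM ACO θ ⇔ ApplicableToClass RuleM 𝒯 θ)
lemma6p1 θ = mk⇔ applicableTo⇒applicableToClass (fromClass ∘ applicableToClass-mono ACO⇒𝒯)
           , mk⇔ (applicableToClass-mono ACO⇒𝒯) (applicableTo⇒applicableToClass ∘ fromClass)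
  where
  fromClass : ApplicableToClass RuleM 𝒯 θ → ApplicableTo RuleM θ
  fromClass = M-applicableToClass⇒applicableTo 𝒯⇒∼
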